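{- Let $a_{1}<a_{2}<a_{3}<\cdots$ be a strictly increasing infinite sequence of positive integers, let $A=\{a_{1},a_{2},a_{3},\ldots\}$, and let $n>0$ be an integer such that: (1) whenever $m>n$, there exist indices $i<r\leq s<j$ with $a_{m}=a_{i}+a_{j}=a_{r}+a_{s}$; and (2) whenever $a=a_{i}+a_{j}=a_{r}+a_{s}>a_{n}$ for some indices $i<r<s<j$, then $a=a_{m}$ for some $m>n$. Suppose $d,a,b$ are integers such that the five numbers $d,a,b,a+d,b+d$ are pairwise distinct and all belong to $A$, and suppose $a_{n}<k$ where $k=a+b+d$. Then every positive multiple of $k$ belongs to $A$, i.e., $mk\in A$ for all integers $m\geq 1$. -}

module Defs where

open import Data.Nat using (ℕ; _+_; _*_; _<_; _≤_)
open import Data.Product using (∃-syntax; _×_)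
open import Relation.Binary.PropositionalEquality using (_≡_)

-- Sequences are indexed from 1 (the value at index 0 is ignored).
-- a₁ < a₂ < a₃ < ⋯ is a strictly increasing sequence of positive integers.
StrictlyIncreasingPos : (ℕ → ℕ) → Set
StrictlyIncreasingPos a =
  (∀ i → 1 ≤ i → 0 < a i) × (∀ i j → 1 ≤ i → i < j → a i < a j)

InSeq : (ℕ → ℕ) → ℕ → Set
InSeq a x = ∃[ i ] (1 ≤ i × a i ≡ x)

Cond1 : (ℕ → ℕ) → ℕ → Set
Cond1 a n = ∀ m → n < m →
  ∃[ i ] ∃[ r ] ∃[ s ] ∃[ j ]
    (1 ≤ i × i < r × r ≤ s × s < j ×
     a m ≡ a i + a j × a m ≡ a r + a s)

Cond2 : (ℕ → ℕ) → ℕ → Set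
Cond2 a n = ∀ x i r s j → 1 ≤ i → i < r → r < s → s < j →
  x ≡ a i + a j → x ≡ a r + a s → a n < x →
  ∃[ m ] (n < m × a m ≡ x)

{-# OPTIONS --safe #-}
module Submission where

open import Defs
open import Data.Nat using (ℕ; zero; suc; _+_; _*_; _<_; _≤_)
open import Data.Nat.Properties
open import Data.Nat.Tactic.RingSolver using (solve-∀)
open import Data.Product using (_×_; _,_; proj₁; proj₂)
open import Data.Empty using (⊥-elim)
open import Relation.Binary.Definitions using (tri<; tri≈; tri>)
open import Relation.Binary.PropositionalEquality

-- By condition (2), a number above a_n that is written as p + q = r + s
-- with p, q, r, s four distinct elements of A lies in A.  With k = x + y + d,
--   k = (x + d) + y = (y + d) + x,    k + d = (x + d) + (y + d) = d + k,
--   k + (x + d) = (k + d) + x,        k + (y + d) = (k + d) + y,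
-- so k, k + d, k + x + d and k + y + d lie in A.  The same identities shifted by
-- m k give an induction on m.  Taking x < y by symmetry, the four summands of each
-- identity are distinct because x < y and y ≠ x + d when m = 0, and by size when
-- m ≥ 1.

+-balance-< : ∀ {α β γ δ} → α < β → α + δ ≡ β + γ → γ < δ
+-balance-< {α} {β} {γ} {δ} α<β eq = +-cancelˡ-< α γ δ (begin-strict
    α + γ <⟨ +-monoˡ-< γ α<β ⟩
    β + γ ≡⟨ sym eq ⟩
    α + δ ∎)
  where open ≤-Reasoning

≢-+-multiple : ∀ {u v k} m → u < k → u ≢ v → u ≢ m * k + v
≢-+-multiple zero _ u≢v = u≢v
≢-+-multiple {u} {v} {k} (suc m) u<k _ =
  <⇒≢ (<-≤-trans u<k (≤-trans (m≤m+n k (m * k)) (m≤m+n (suc m * k) v)))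

module _ {a : ℕ → ℕ} (a-inc : StrictlyIncreasingPos a) where

  ∈A⇒>0 : ∀ {v} → InSeq a v → 0 < v
  ∈A⇒>0 (i , 1≤i , refl) = proj₁ a-inc i 1≤i

  a-reflects-< : ∀ {i j} → 1 ≤ j → a i < a j → i < j
  a-reflects-< {i} {j} 1≤j ai<aj with <-cmp i j
  ... | tri< i<j _ _ = i<j
  ... | tri≈ _ refl _ = ⊥-elim (<-irrefl refl ai<aj)
  ... | tri> _ _ j<i = ⊥-elim (<-asym ai<aj (proj₂ a-inc j i 1≤j j<i))

  module _ {n} (n>0 : 0 < n) (cond2 : Cond2 a n) where

    ordered-sum∈A : ∀ {α β γ δ} → InSeq a α → InSeq a β → InSeq a γ → InSeq a δ →
                    α < β → β < γ → α + δ ≡ β + γ → a n < α + δ → InSeq a (α + δ)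
    ordered-sum∈A (i , 1≤i , refl) (r , 1≤r , refl) (s , 1≤s , refl) (j , 1≤j , refl) α<β β<γ eq big
      with cond2 _ i r s j 1≤i (a-reflects-< 1≤r α<β) (a-reflects-< 1≤s β<γ)
                 (a-reflects-< 1≤j (+-balance-< α<β eq)) refl eq big
    ... | m , n<m , am≡ = m , <-trans n>0 n<m , am≡

    sum∈A : ∀ {α β γ δ t} → InSeq a α → InSeq a β → InSeq a γ → InSeq a δ →
            α < β → α < γ → β ≢ γ → α + δ ≡ t → β + γ ≡ t → a n < t → InSeq a t
    sum∈A {β = β} {γ} α∈A β∈A γ∈A δ∈A α<β α<γ β≢γ refl βγ≡t big with <-cmp β γ
    ... | tri< β<γ _ _ = ordered-sum∈A α∈A β∈A γ∈A δ∈A α<β β<γ (sym βγ≡t) big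
    ... | tri≈ _ β≡γ _ = ⊥-elim (β≢γ β≡γ)
    ... | tri> _ _ γ<β = ordered-sum∈A α∈A γ∈A β∈A δ∈A α<γ γ<β (sym (trans (+-comm γ β) βγ≡t)) big

    module Multiples {d x y : ℕ} (x<y : x < y) (y≢x+d : y ≢ x + d)
                     (d∈A : InSeq a d) (x∈A : InSeq a x) (y∈A : InSeq a y)
                     (x+d∈A : InSeq a (x + d)) (y+d∈A : InSeq a (y + d))
                     (big : a n < x + y + d) where

      K : ℕ
      K = x + y + d

      d>0 : 0 < d
      d>0 = ∈A⇒>0 d∈A

      x>0 : 0 < x
      x>0 = ∈A⇒>0 x∈A

      y>0 : 0 < y
      y>0 = ∈A⇒>0 y∈A

      x+d<K : x + d < K
      x+d<K = +-monoˡ-< d (m<m+n x y>0)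

      y+d<K : y + d < K
      y+d<K = +-monoˡ-< d (m<n+m y x>0)

      K≤[1+m]K+ : ∀ m t → K ≤ suc m * K + t
      K≤[1+m]K+ m t = ≤-trans (m≤m+n K (m * K)) (m≤m+n (suc m * K) t)

      ≥K⇒>aₙ : ∀ {v} → K ≤ v → a n < v
      ≥K⇒>aₙ = <-≤-trans big

      Shifted : ℕ → Set
      Shifted m = InSeq a (m * K + (x + d)) × InSeq a (m * K + (y + d))

      multiple∈A : ∀ m → Shifted m → InSeq a (suc m * K)
      multiple∈A m (x+d+mK∈A , y+d+mK∈A) =
        sum∈A x∈A y∈A x+d+mK∈A y+d+mK∈A x<y
          (<-≤-trans (m<m+n x d>0) (m≤n+m (x + d) (m * K)))
          (≢-+-multiple m (<-trans (m<m+n y d>0) y+d<K) y≢x+d)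
          (via-y+d m x y d) (via-x+d m x y d)
          (≥K⇒>aₙ (m≤m+n K (m * K)))
        where
          via-y+d : ∀ m x y d → x + (m * (x + y + d) + (y + d)) ≡ suc m * (x + y + d)
          via-y+d = solve-∀
          via-x+d : ∀ m x y d → y + (m * (x + y + d) + (x + d)) ≡ suc m * (x + y + d)
          via-x+d = solve-∀

      multiple+d∈A : ∀ m → Shifted m → InSeq a (suc m * K + d)
      multiple+d∈A m shifted@(x+d+mK∈A , _) =
        sum∈A d∈A x+d+mK∈A y+d∈A (multiple∈A m shifted)
          (<-≤-trans (m<n+m d x>0) (m≤n+m (x + d) (m * K)))
          (m<n+m d y>0)
          (≢-sym (≢-+-multiple m y+d<K (>⇒≢ (+-monoˡ-< d x<y))))
          (+-comm d (suc m * K)) (both-shifts m x y d)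
          (≥K⇒>aₙ (K≤[1+m]K+ m d))
        where
          both-shifts : ∀ m x y d → m * (x + y + d) + (x + d) + (y + d) ≡ suc m * (x + y + d) + d
          both-shifts = solve-∀

      shifted-step : ∀ m → Shifted m → ∀ {u} → InSeq a u → InSeq a (u + d) → u + d < K →
                     InSeq a (suc m * K + (u + d))
      shifted-step m shifted {u} u∈A u+d∈A u+d<K =
        sum∈A u∈A u+d∈A (multiple∈A m shifted) (multiple+d∈A m shifted)
          (m<m+n u d>0) (≤-<-trans (m≤m+n u d) u+d<[1+m]K) (<⇒≢ u+d<[1+m]K)
          (exchange u (suc m * K) d) (+-comm (u + d) (suc m * K))
          (≥K⇒>aₙ (K≤[1+m]K+ m (u + d)))
        where
          u+d<[1+m]K : u + d < suc m * K
          u+d<[1+m]K = <-≤-trans u+d<K (m≤m+n K (m * K))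
          exchange : ∀ u v d → u + (v + d) ≡ v + (u + d)
          exchange = solve-∀

      shifted : ∀ m → Shifted m
      shifted zero = x+d∈A , y+d∈A
      shifted (suc m) = shifted-step m (shifted m) x∈A x+d∈A x+d<K
                      , shifted-step m (shifted m) y∈A y+d∈A y+d<K

      multiples∈A : ∀ m → 1 ≤ m → InSeq a (m * K)
      multiples∈A (suc m) _ = multiple∈A m (shifted m)

lemma1 : (a : ℕ → ℕ) → StrictlyIncreasingPos a →
    (n : ℕ) → 0 < n → Cond1 a n → Cond2 a n →
    (d x y : ℕ) →
    d ≢ x → d ≢ y → d ≢ x + d → d ≢ y + d →
    x ≢ y → x ≢ x + d → x ≢ y + d →
    y ≢ x + d → y ≢ y + d →
    x + d ≢ y + d →
    InSeq a d → InSeq a x → InSeq a y → InSeq a (x + d) → InSeq a (y + d) →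
    a n < x + y + d →
    ∀ m → 1 ≤ m → InSeq a (m * (x + y + d))
lemma1 a a-inc n n>0 _ cond2 d x y _ _ _ _ x≢y _ x≢y+d y≢x+d _ _
       d∈A x∈A y∈A x+d∈A y+d∈A big m 1≤m with <-cmp x y
... | tri< x<y _ _ =
  Multiples.multiples∈A a-inc n>0 cond2 x<y y≢x+d d∈A x∈A y∈A x+d∈A y+d∈A big m 1≤m
... | tri≈ _ x≡y _ = ⊥-elim (x≢y x≡y)
... | tri> _ _ y<x = subst (λ k → InSeq a (m * k)) y+x+d≡x+y+d
  (Multiples.multiples∈A a-inc n>0 cond2 y<x x≢y+d d∈A y∈A x∈A y+d∈A x+d∈A
     (subst (a n <_) (sym y+x+d≡x+y+d) big) m 1≤m)
  where
    y+x+d≡x+y+d : y + x + d ≡ x + y + d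
    y+x+d≡x+y+d = cong (_+ d) (+-comm y x)
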